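{- Let $\mathcal{G}=(L,\vee,\wedge,\odot,\rightarrow,0,1)$ be an involutive right-residuated l-groupoid with derived implication $\Rightarrow$. Then for all $x,y,z\in L$: (I0) $(x\vee y)\Rightarrow y=x\Rightarrow y$, $x\Rightarrow x=1$, $1\Rightarrow x=x$; (I1) $(x\Rightarrow y)\wedge y=y$; (I2) $x\le y$ implies $y\Rightarrow z\le x\Rightarrow z$. Moreover, $x\le y$ if and only if $x\Rightarrow y=1$.
   Context: A right-residuated l-groupoid is an algebra $(L,\vee,\wedge,\odot,\rightarrow,0,1)$ of type $(2,2,2,2,0,0)$ such that $(L,\vee,\wedge)$ is a lattice with least element $0$ and greatest element $1$, $1\odot x=x$ for all $x$, and $x\odot y\le z$ iff $x\le y\rightarrow z$ for all $x,y,z$. Put $\rceil x:=x\rightarrow 0$; $\mathcal{G}$ is involutive if $x\le y$ implies $\rceil y\le\rceil x$ and $\rceil\rceil x=x$ for all $x,y$. The derived implication is $x\Rightarrow y:=\rceil y\rightarrow\rceil x$. -}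

module Defs where

open import Level using (Level; suc; _⊔_)
open import Relation.Binary.PropositionalEquality using (_≡_)
open import Algebra.Lattice.Structures using (IsLattice)
open import Algebra.Core using (Op₂)
open import Data.Product using (_×_)

record RightResiduatedLGroupoid (a : Level) : Set (suc a) where
  infixr 6 _∨_
  infixr 7 _∧_
  infixr 8 _⊙_
  infixr 5 _⟶_
  infix 4 _≤_
  field
    Carrier   : Set a
    _∨_ _∧_ _⊙_ _⟶_ : Op₂ Carrier
    𝟘 𝟙       : Carrier
    isLattice : IsLattice _≡_ _∨_ _∧_

  _≤_ : Carrier → Carrier → Set a
  x ≤ y = x ∧ y ≡ x

  field
    𝟘-least    : ∀ x → 𝟘 ≤ x
    𝟙-greatest : ∀ x → x ≤ 𝟙
    ⊙-identityˡ : ∀ x → 𝟙 ⊙ x ≡ x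
    residuation-⇒ : ∀ x y z → x ⊙ y ≤ z → x ≤ (y ⟶ z)
    residuation-⇐ : ∀ x y z → x ≤ (y ⟶ z) → x ⊙ y ≤ z

  ⌉ : Carrier → Carrier
  ⌉ x = x ⟶ 𝟘

  infixr 5 _⇒_
  _⇒_ : Carrier → Carrier → Carrier
  x ⇒ y = ⌉ y ⟶ ⌉ x

  Involutive : Set a
  Involutive = (∀ x y → x ≤ y → ⌉ y ≤ ⌉ x) × (∀ x → ⌉ (⌉ x) ≡ x)

-- In an involutive groupoid ⌉ is an order-reversing involution, hence a dual lattice
-- automorphism that swaps 𝟘 and 𝟙. Since 𝟙 is a left unit, residuation gives 𝟙 ≤ u ⟶ v iff
-- u ≤ v; for x ⇒ y = ⌉y ⟶ ⌉x this says x ⇒ y = 𝟙 iff ⌉y ≤ ⌉x iff x ≤ y. The remaining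
-- identities follow from monotonicity of ⊙ and ⟶, De Morgan for ⌉, and y ⊙ ⌉y ≤ 𝟘.
module Submission where

open import Defs
open import Level using (Level)
open import Relation.Binary.PropositionalEquality
  using (_≡_; refl; sym; trans; cong; subst; subst₂; isEquivalence; module ≡-Reasoning)
open import Data.Product using (_×_; _,_; proj₁; proj₂)
open import Function using (_⇔_; mk⇔; Equivalence)
open import Relation.Binary.Bundles using (Poset)
open import Algebra.Lattice.Bundles using (Lattice)
open import Algebra.Lattice.Structures using (IsLattice)
import Algebra.Lattice.Properties.Lattice as LatticeProperties
import Relation.Binary.Lattice as OrderLattice
import Relation.Binary.Reasoning.PartialOrder as PosetReasoning

module LatticeOrder {a : Level} (G : RightResiduatedLGroupoid a) where
  open RightResiduatedLGroupoid G

  private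
    lattice : Lattice a a
    lattice = record { isLattice = isLattice }

    -- The library orders a lattice by x ≈ x ∧ y, the symmetric form of x ∧ y ≡ x.
    module ≼ = OrderLattice.Lattice (LatticeProperties.∨-∧-orderTheoreticLattice lattice)

  ≤-refl : ∀ {x} → x ≤ x
  ≤-refl = sym ≼.refl

  ≤-trans : ∀ {x y z} → x ≤ y → y ≤ z → x ≤ z
  ≤-trans p q = sym (≼.trans (sym p) (sym q))

  ≤-antisym : ∀ {x y} → x ≤ y → y ≤ x → x ≡ y
  ≤-antisym p q = ≼.antisym (sym p) (sym q)

  ≤-poset : Poset a a a
  ≤-poset = record
    { _≤_ = _≤_
    ; isPartialOrder = record
      { isPreorder = record
        { isEquivalence = isEquivalence
        ; reflexive = λ { refl → ≤-refl }
        ; trans = ≤-trans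
        }
      ; antisym = ≤-antisym
      }
    }

  x≤x∨y : ∀ x y → x ≤ x ∨ y
  x≤x∨y x y = sym (≼.x≤x∨y x y)

  ∨-least : ∀ {x y z} → x ≤ z → y ≤ z → x ∨ y ≤ z
  ∨-least p q = sym (≼.∨-least (sym p) (sym q))

  x∧y≤x : ∀ x y → x ∧ y ≤ x
  x∧y≤x x y = sym (≼.x∧y≤x x y)

  x∧y≤y : ∀ x y → x ∧ y ≤ y
  x∧y≤y x y = sym (≼.x∧y≤y x y)

  ∧-greatest : ∀ {x y z} → x ≤ y → x ≤ z → x ≤ y ∧ z
  ∧-greatest p q = sym (≼.∧-greatest (sym p) (sym q))

  𝟙-unique : ∀ {x} → 𝟙 ≤ x → x ≡ 𝟙
  𝟙-unique p = ≤-antisym (𝟙-greatest _) p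

module Residuation {a : Level} (G : RightResiduatedLGroupoid a) where
  open RightResiduatedLGroupoid G
  open LatticeOrder G

  ⟶-counit : ∀ y z → (y ⟶ z) ⊙ y ≤ z
  ⟶-counit y z = residuation-⇐ _ y z ≤-refl

  ⊙-monoˡ-≤ : ∀ c {x y} → x ≤ y → x ⊙ c ≤ y ⊙ c
  ⊙-monoˡ-≤ c {y = y} p = residuation-⇐ _ c _ (≤-trans p (residuation-⇒ y c _ ≤-refl))

  ⟶-monoʳ-≤ : ∀ c {x y} → x ≤ y → (c ⟶ x) ≤ (c ⟶ y)
  ⟶-monoʳ-≤ c {x} p = residuation-⇒ _ c _ (≤-trans (⟶-counit c x) p)

  x⊙y≤y : ∀ x y → x ⊙ y ≤ y
  x⊙y≤y x y = subst (x ⊙ y ≤_) (⊙-identityˡ y) (⊙-monoˡ-≤ y (𝟙-greatest x))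

  𝟙≤⟶⇔≤ : ∀ {y z} → 𝟙 ≤ (y ⟶ z) ⇔ y ≤ z
  𝟙≤⟶⇔≤ {y} {z} = mk⇔
    (λ p → subst (_≤ z) (⊙-identityˡ y) (residuation-⇐ 𝟙 y z p))
    (λ p → residuation-⇒ 𝟙 y z (subst (_≤ z) (sym (⊙-identityˡ y)) p))

  ⌉𝟘≡𝟙 : ⌉ 𝟘 ≡ 𝟙
  ⌉𝟘≡𝟙 = 𝟙-unique (Equivalence.from 𝟙≤⟶⇔≤ ≤-refl)

module InvolutiveNegation {a : Level} (G : RightResiduatedLGroupoid a)
  (involutive : RightResiduatedLGroupoid.Involutive G) where
  open RightResiduatedLGroupoid G
  open LatticeOrder G
  open Residuation G

  ⌉-antitone : ∀ {x y} → x ≤ y → ⌉ y ≤ ⌉ x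
  ⌉-antitone = proj₁ involutive _ _

  ⌉-involutive : ∀ x → ⌉ (⌉ x) ≡ x
  ⌉-involutive = proj₂ involutive

  ⌉-reflects-≤ : ∀ {x y} → ⌉ y ≤ ⌉ x → x ≤ y
  ⌉-reflects-≤ {x} {y} p = subst₂ _≤_ (⌉-involutive x) (⌉-involutive y) (⌉-antitone p)

  ⌉-swap : ∀ {x y} → x ≤ ⌉ y → y ≤ ⌉ x
  ⌉-swap {x} {y} p = subst (_≤ ⌉ x) (⌉-involutive y) (⌉-antitone p)

  ⌉𝟙≡𝟘 : ⌉ 𝟙 ≡ 𝟘
  ⌉𝟙≡𝟘 = subst (λ t → ⌉ t ≡ 𝟘) ⌉𝟘≡𝟙 (⌉-involutive 𝟘)

  ⌉-∧≤⌉-∨ : ∀ x y → ⌉ x ∧ ⌉ y ≤ ⌉ (x ∨ y)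
  ⌉-∧≤⌉-∨ x y = ⌉-swap (∨-least (⌉-swap (x∧y≤x (⌉ x) (⌉ y))) (⌉-swap (x∧y≤y (⌉ x) (⌉ y))))

  x⊙⌉x≤𝟘 : ∀ x → x ⊙ ⌉ x ≤ 𝟘
  x⊙⌉x≤𝟘 x = residuation-⇐ x (⌉ x) 𝟘 (subst (x ≤_) (sym (⌉-involutive x)) ≤-refl)

module DerivedImplication {a : Level} (G : RightResiduatedLGroupoid a)
  (involutive : RightResiduatedLGroupoid.Involutive G) where
  open RightResiduatedLGroupoid G
  open LatticeOrder G
  open Residuation G
  open InvolutiveNegation G involutive
  open IsLattice isLattice using (∧-comm)

  ⇒-antitoneˡ : ∀ {x y} z → x ≤ y → (y ⇒ z) ≤ (x ⇒ z)
  ⇒-antitoneˡ z p = ⟶-monoʳ-≤ (⌉ z) (⌉-antitone p)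

  ⇒≡𝟙⇔≤ : ∀ {x y} → (x ⇒ y) ≡ 𝟙 ⇔ x ≤ y
  ⇒≡𝟙⇔≤ {x} {y} = mk⇔
    (λ e → ⌉-reflects-≤ (Equivalence.to 𝟙≤⟶⇔≤ (subst (𝟙 ≤_) (sym e) ≤-refl)))
    (λ p → 𝟙-unique (Equivalence.from 𝟙≤⟶⇔≤ (⌉-antitone p)))

  ⇒-refl : ∀ x → (x ⇒ x) ≡ 𝟙
  ⇒-refl x = Equivalence.from ⇒≡𝟙⇔≤ ≤-refl

  𝟙⇒x≡x : ∀ x → (𝟙 ⇒ x) ≡ x
  𝟙⇒x≡x x = begin
    ⌉ x ⟶ ⌉ 𝟙  ≡⟨ cong (⌉ x ⟶_) ⌉𝟙≡𝟘 ⟩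
    ⌉ (⌉ x)    ≡⟨ ⌉-involutive x ⟩
    x          ∎
    where open ≡-Reasoning

  y≤x⇒y : ∀ x y → y ≤ (x ⇒ y)
  y≤x⇒y x y = residuation-⇒ y (⌉ y) (⌉ x) (≤-trans (x⊙⌉x≤𝟘 y) (𝟘-least (⌉ x)))

  x⇒y∧y≡y : ∀ x y → ((x ⇒ y) ∧ y) ≡ y
  x⇒y∧y≡y x y = trans (∧-comm (x ⇒ y) y) (y≤x⇒y x y)

  x∨y⇒y≡x⇒y : ∀ x y → ((x ∨ y) ⇒ y) ≡ (x ⇒ y)
  x∨y⇒y≡x⇒y x y =
    ≤-antisym (⇒-antitoneˡ y (x≤x∨y x y)) (residuation-⇒ (x ⇒ y) (⌉ y) (⌉ (x ∨ y)) ⊙-bound)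
    where
    open PosetReasoning ≤-poset
    ⊙-bound : (x ⇒ y) ⊙ ⌉ y ≤ ⌉ (x ∨ y)
    ⊙-bound = begin
      (x ⇒ y) ⊙ ⌉ y  ≤⟨ ∧-greatest (⟶-counit (⌉ y) (⌉ x)) (x⊙y≤y (x ⇒ y) (⌉ y)) ⟩
      ⌉ x ∧ ⌉ y      ≤⟨ ⌉-∧≤⌉-∨ x y ⟩
      ⌉ (x ∨ y)      ∎

lemma2 : {a : Level} (G : RightResiduatedLGroupoid a) →
    let open RightResiduatedLGroupoid G in
    Involutive →
    (∀ x y → ((x ∨ y) ⇒ y) ≡ (x ⇒ y)) ×
    (∀ x → (x ⇒ x) ≡ 𝟙) ×
    (∀ x → (𝟙 ⇒ x) ≡ x) ×
    (∀ x y → ((x ⇒ y) ∧ y) ≡ y) ×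
    (∀ x y z → x ≤ y → (y ⇒ z) ≤ (x ⇒ z)) ×
    (∀ x y → (x ≤ y → (x ⇒ y) ≡ 𝟙) × ((x ⇒ y) ≡ 𝟙 → x ≤ y))
lemma2 G involutive =
  x∨y⇒y≡x⇒y , ⇒-refl , 𝟙⇒x≡x , x⇒y∧y≡y , (λ x y z → ⇒-antitoneˡ z) ,
  λ x y → Equivalence.from ⇒≡𝟙⇔≤ , Equivalence.to ⇒≡𝟙⇔≤
  where open DerivedImplication G involutive
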